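{- Let $n=2^k m$ or $n=p^k$, where $k$ and $m$ are positive integers, $m>1$ is odd, and $p$ is an odd prime. Then the unitary Cayley graph $U_n$ has a total coloring with $\Delta+1=\phi(n)+1$ colors, where $\Delta$ is its maximum degree.
   Context: A total coloring of a simple graph $G$ is an assignment of colors to its vertices and edges such that adjacent vertices receive different colors, adjacent edges (edges sharing an endpoint) receive different colors, and each edge receives a color different from both of its endpoints. The unitary Cayley graph $U_n$ is the graph with vertex set $\mathbb{Z}_n=\{0,1,\dots,n-1\}$ in which $x$ and $y$ are adjacent iff $\gcd(x-y,n)=1$ (equivalently, the Cayley graph of $\mathbb{Z}_n$ with connection set $\{i: 1\le i<n,\ \gcd(i,n)=1\}$); it is $\phi(n)$-regular, where $\phi$ is Euler's totient function. -}

module Defs where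

open import Data.Nat using (ℕ; zero; suc; _+_; ∣_-_∣)
open import Data.Nat.GCD using (gcd)
open import Data.Fin using (Fin; toℕ)
open import Data.List using (List; length; filter; upTo)
open import Data.Nat using (_≟_)
open import Relation.Binary.PropositionalEquality using (_≡_; _≢_)
open import Data.Product using (_×_)

-- Euler's totient: number of i with 1 ≤ i ≤ n and gcd(i, n) = 1
-- (so φ 1 = 1; we count i ∈ {1,…,n}).
φ : ℕ → ℕ
φ n = length (filter (λ i → gcd (suc i) n ≟ 1) (upTo n))

-- Using |x - y| is harmless since gcd(n - a, n) = gcd(a, n).
UAdj : (n : ℕ) → Fin n → Fin n → Set
UAdj n x y = (x ≢ y) × (gcd ∣ toℕ x - toℕ y ∣ n ≡ 1)

record TotalColoring (n k : ℕ) : Set where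
  field
    vcol : Fin n → Fin k
    ecol : (x y : Fin n) → UAdj n x y → Fin k
    ecol-sym : ∀ x y (a : UAdj n x y) (b : UAdj n y x) → ecol x y a ≡ ecol y x b
    ecol-irr : ∀ x y (a b : UAdj n x y) → ecol x y a ≡ ecol x y b
    vertex-proper : ∀ x y → UAdj n x y → vcol x ≢ vcol y
    edge-proper : ∀ x y z (a : UAdj n x y) (b : UAdj n x z) →
                  y ≢ z → ecol x y a ≢ ecol x z b
    incidence-proper : ∀ x y (a : UAdj n x y) →
                  (ecol x y a ≢ vcol x) × (ecol x y a ≢ vcol y)

-- A vertex x is coloured like the loop {x, x}: a colouring of pairs that is symmetric on
-- edges, injective on every closed neighbourhood and distinguishes the loops at adjacent
-- vertices is a total colouring, and its colours are the φ(n) units of ℤ_n plus one extra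
-- colour.  For n = p^(k+1) the graph is complete p-partite over the residues mod p; a pair
-- is coloured by the difference of its residues (their sum within a layer) together with
-- the sum of its layers.  For n = 2^(k+1) m the graph is bipartite and an edge is coloured
-- by its oriented difference, except that the edges whose difference is one of q - 1
-- chosen units (q the least prime factor of m) are recoloured, by the class of x + y mod q,
-- to free colours for the vertices.
module Submission where

open import Defs
open import Data.Nat using (ℕ; zero; suc; pred; _+_; _*_; _^_; _∸_; ∣_-_∣; _≤_; _<_; _≟_; z≤n; s≤s; s≤s⁻¹; NonZero; ≢-nonZero⁻¹; >-nonZero; nonTrivial⇒≢1)
open import Data.Nat.Properties
open import Data.Nat.DivMod using (_%_; _/_; m≡m%n+[m/n]*n; m%n<n; m%n%n≡m%n; m<n⇒m%n≡m; n%n≡0; [m+kn]%n≡m%n; %-remove-+ˡ; %-remove-+ʳ; m<n*o⇒m/o<n)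
open import Data.Nat.Divisibility using (_∣_; divides; _∣?_; ∣-refl; ∣-trans; _∣0; 0∣⇒≡0; ∣1⇒≡1; ∣⇒≤; ∣m+n∣m⇒∣n; ∣m⇒∣m*n; ∣n⇒∣m*n; m∣m*n; n∣m⇒m%n≡0)
open import Data.Nat.GCD using (gcd)
open import Data.Nat.Coprimality using (Coprime; coprime⇒gcd≡1; gcd≡1⇒coprime; coprime-divisor; coprime-+)
open import Data.Nat.Primality using (Prime; _Rough_; prime⇒irreducible; prime⇒nonZero; prime⇒nonTrivial; prime[2]; 2-rough; ∤⇒rough-suc)
open import Data.Nat.Divisibility.Core using (hasNonTrivialDivisor)
open import Data.Fin using (Fin; toℕ; fromℕ<)
open import Data.Fin.Properties using (toℕ<n; toℕ-injective; fromℕ<-cong; fromℕ<-injective)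
open import Data.List using ([]; length; filter; upTo; _++_; [_])
open import Data.List.Properties using (upTo-∷ʳ; filter-++; length-++; filter-accept)
open import Data.Maybe using (Maybe; just; nothing)
open import Data.Maybe.Properties using (just-injective)
open import Data.Maybe.Relation.Unary.All using (All; just; nothing)
open import Data.Product using (_×_; _,_; proj₁; proj₂; ∃-syntax)
open import Data.Sum using (_⊎_; inj₁; inj₂)
open import Function.Bundles using (_⇔_; mk⇔; Equivalence)
open import Function.Base using (_∘_)
open import Relation.Unary using (Decidable)
open import Relation.Nullary using (¬_; Dec; yes; no; contradiction)
open import Relation.Binary.Definitions using (tri<; tri≈; tri>)
open import Relation.Binary.PropositionalEquality using (_≡_; _≢_; refl; sym; trans; cong; cong₂; subst; subst₂; module ≡-Reasoning)

open Equivalence using (to; from)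

prime∤⇒coprime : ∀ {p a} → Prime p → ¬ p ∣ a → Coprime a p
prime∤⇒coprime p-prime p∤a (i∣a , i∣p) with prime⇒irreducible p-prime i∣p
... | inj₁ i≡1 = i≡1
... | inj₂ refl = contradiction i∣a p∤a

coprime-*ʳ : ∀ {a b c} → Coprime a b → Coprime a c → Coprime a (b * c)
coprime-*ʳ {a} {b} cop-ab cop-ac {i} (i∣a , i∣bc) = cop-ac (i∣a , coprime-divisor cop-ib i∣bc)
  where
  cop-ib : Coprime i b
  cop-ib (j∣i , j∣b) = cop-ab (∣-trans j∣i i∣a , j∣b)

coprime-^ʳ : ∀ {a b} → Coprime a b → ∀ k → Coprime a (b ^ k)
coprime-^ʳ cop zero    (_ , i∣1) = ∣1⇒≡1 i∣1
coprime-^ʳ cop (suc k) = coprime-*ʳ cop (coprime-^ʳ cop k)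

coprime⇒>0 : ∀ {u n} → 1 < n → Coprime u n → 0 < u
coprime⇒>0 {zero}  {n} 1<n cop = contradiction (cop (n ∣0 , ∣-refl)) (>⇒≢ 1<n)
coprime⇒>0 {suc u} 1<n cop = s≤s z≤n

module _ {d : ℕ} .{{_ : NonZero d}} where

  %≡%⇒∣∣-∣ : ∀ {a b} → a % d ≡ b % d → d ∣ ∣ a - b ∣
  %≡%⇒∣∣-∣ {a} {b} eq = divides ∣ a / d - b / d ∣ (begin
      ∣ a - b ∣                                 ≡⟨ cong₂ ∣_-_∣ (m≡m%n+[m/n]*n a d) (m≡m%n+[m/n]*n b d) ⟩
      ∣ a % d + a / d * d - b % d + b / d * d ∣ ≡⟨ cong (λ r → ∣ r + a / d * d - b % d + b / d * d ∣) eq ⟩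
      ∣ b % d + a / d * d - b % d + b / d * d ∣ ≡⟨ ∣m+n-m+o∣≡∣n-o∣ (b % d) (a / d * d) (b / d * d) ⟩
      ∣ a / d * d - b / d * d ∣                 ≡⟨ sym (*-distribʳ-∣-∣ d (a / d) (b / d)) ⟩
      ∣ a / d - b / d ∣ * d                     ∎)
    where open ≡-Reasoning

  ∣∸⇒%≡% : ∀ {a b} → a ≤ b → d ∣ b ∸ a → b % d ≡ a % d
  ∣∸⇒%≡% {a} {b} a≤b (divides k eq) = begin
    b % d             ≡⟨ cong (_% d) (sym (m+[n∸m]≡n a≤b)) ⟩
    (a + (b ∸ a)) % d ≡⟨ cong (λ r → (a + r) % d) eq ⟩
    (a + k * d) % d   ≡⟨ [m+kn]%n≡m%n a k d ⟩
    a % d             ∎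
    where open ≡-Reasoning

  ∣∣-∣⇒%≡% : ∀ {a b} → d ∣ ∣ a - b ∣ → a % d ≡ b % d
  ∣∣-∣⇒%≡% {a} {b} d∣ with ≤-total a b
  ... | inj₁ a≤b = sym (∣∸⇒%≡% a≤b (subst (d ∣_) (m≤n⇒∣m-n∣≡n∸m a≤b) d∣))
  ... | inj₂ b≤a = ∣∸⇒%≡% b≤a (subst (d ∣_) (m≤n⇒∣n-m∣≡n∸m b≤a) d∣)

  %≡%⇒≡ : ∀ {a b} → a < d → b < d → a % d ≡ b % d → a ≡ b
  %≡%⇒≡ a<d b<d eq = trans (sym (m<n⇒m%n≡m a<d)) (trans eq (m<n⇒m%n≡m b<d))

  +-cancelˡ-% : ∀ a {b c} → (a + b) % d ≡ (a + c) % d → b % d ≡ c % d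
  +-cancelˡ-% a {b} {c} eq = ∣∣-∣⇒%≡% (subst (d ∣_) (∣m+n-m+o∣≡∣n-o∣ a b c) (%≡%⇒∣∣-∣ eq))

  %-cong-+ˡ : ∀ a {b c} → b % d ≡ c % d → (a + b) % d ≡ (a + c) % d
  %-cong-+ˡ a {b} {c} eq = ∣∣-∣⇒%≡% (subst (d ∣_) (sym (∣m+n-m+o∣≡∣n-o∣ a b c)) (%≡%⇒∣∣-∣ eq))

  %-cong-+ʳ : ∀ {a b} c → a % d ≡ b % d → (a + c) % d ≡ (b + c) % d
  %-cong-+ʳ {a} {b} c eq = subst₂ (λ u v → u % d ≡ v % d) (+-comm c a) (+-comm c b) (%-cong-+ˡ c eq)

  +-cancelʳ-% : ∀ {a b} c → (a + c) % d ≡ (b + c) % d → a % d ≡ b % d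
  +-cancelʳ-% {a} {b} c eq = +-cancelˡ-% c (subst₂ (λ u v → u % d ≡ v % d) (+-comm a c) (+-comm b c) eq)

  double-cancel-% : ¬ 2 ∣ d → ∀ {a b} → (a + a) % d ≡ (b + b) % d → a % d ≡ b % d
  double-cancel-% d-odd {a} {b} eq =
    ∣∣-∣⇒%≡% (coprime-divisor (prime∤⇒coprime prime[2] d-odd) (subst (d ∣_) doubled (%≡%⇒∣∣-∣ eq)))
    where
    doubled : ∣ a + a - b + b ∣ ≡ 2 * ∣ a - b ∣
    doubled = trans (cong₂ ∣_-_∣ (cong (a +_) (sym (+-identityʳ a))) (cong (b +_) (sym (+-identityʳ b))))
                    (sym (*-distribˡ-∣-∣ 2 a b))


%≡%-∣ : ∀ {d e} .{{_ : NonZero d}} .{{_ : NonZero e}} → e ∣ d → ∀ {a b} → a % d ≡ b % d → a % e ≡ b % e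
%≡%-∣ e∣d eq = ∣∣-∣⇒%≡% (∣-trans e∣d (%≡%⇒∣∣-∣ eq))

IsUnit : ℕ → ℕ → Set
IsUnit n u = 0 < u × u < n × Coprime u n

-- b − a mod M; the truncated subtraction is harmless only for a ≤ M.
offset : (M : ℕ) .{{_ : NonZero M}} → ℕ → ℕ → ℕ
offset M a b = (M ∸ a + b) % M

module _ {M : ℕ} .{{_ : NonZero M}} where

  offset-< : ∀ a b → offset M a b < M
  offset-< a b = m%n<n (M ∸ a + b) M

  offset-spec : ∀ {a} b → a ≤ M → (a + offset M a b) % M ≡ b % M
  offset-spec {a} b a≤M = begin
    (a + (M ∸ a + b) % M) % M ≡⟨ %-cong-+ˡ a (m%n%n≡m%n (M ∸ a + b) M) ⟩
    (a + (M ∸ a + b)) % M     ≡⟨ cong (_% M) (sym (+-assoc a (M ∸ a) b)) ⟩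
    (a + (M ∸ a) + b) % M     ≡⟨ cong (λ r → (r + b) % M) (m+[n∸m]≡n a≤M) ⟩
    (M + b) % M               ≡⟨ %-remove-+ˡ b ∣-refl ⟩
    b % M                     ∎
    where open ≡-Reasoning

  offset-self : ∀ {a} → a ≤ M → offset M a a ≡ 0
  offset-self a≤M = trans (cong (_% M) (m∸n+n≡m a≤M)) (n%n≡0 M)

  offset≡0⇒%≡% : ∀ {a b} → a ≤ M → offset M a b ≡ 0 → a % M ≡ b % M
  offset≡0⇒%≡% {a} {b} a≤M eq = trans (cong (_% M) (sym (+-identityʳ a)))
    (trans (cong (λ r → (a + r) % M) (sym eq)) (offset-spec b a≤M))

  module _ {e : ℕ} .{{_ : NonZero e}} (e∣M : e ∣ M) where

    offset-spec-∣ : ∀ {a} b → a ≤ M → (a + offset M a b) % e ≡ b % e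
    offset-spec-∣ b a≤M = %≡%-∣ e∣M (offset-spec b a≤M)

    offset-%-congʳ : ∀ {a b c} → a ≤ M → offset M a b % e ≡ offset M a c % e ⇔ b % e ≡ c % e
    offset-%-congʳ {a} {b} {c} a≤M = mk⇔
      (λ eq → trans (sym (offset-spec-∣ b a≤M)) (trans (%-cong-+ˡ a eq) (offset-spec-∣ c a≤M)))
      (λ eq → +-cancelˡ-% a (trans (offset-spec-∣ b a≤M) (trans eq (sym (offset-spec-∣ c a≤M)))))

    offset-%-congˡ : ∀ {a b c} → a ≤ M → b ≤ M → offset M a c % e ≡ offset M b c % e ⇔ a % e ≡ b % e
    offset-%-congˡ {a} {b} {c} a≤M b≤M = mk⇔
      (λ eq → +-cancelʳ-% (offset M b c)
        (trans (sym (%-cong-+ˡ a eq)) (trans (offset-spec-∣ c a≤M) (sym (offset-spec-∣ c b≤M)))))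
      (λ eq → +-cancelˡ-% a
        (trans (offset-spec-∣ c a≤M) (trans (sym (offset-spec-∣ c b≤M)) (%-cong-+ʳ (offset M b c) (sym eq)))))

  offset-coprime : ∀ {a b} → a ≤ M → Coprime ∣ a - b ∣ M → Coprime (offset M a b) M
  offset-coprime {a} {b} a≤M cop {zero} (_ , 0∣M) = contradiction (0∣⇒≡0 0∣M) (≢-nonZero⁻¹ M)
  offset-coprime {a} {b} a≤M cop {i@(suc _)} (i∣offset , i∣M) = cop (%≡%⇒∣∣-∣ {i} {a} {b} a≡b , i∣M)
    where
    a≡b : a % i ≡ b % i
    a≡b = begin
      a % i                  ≡⟨ cong (_% i) (sym (+-identityʳ a)) ⟩
      (a + 0) % i            ≡⟨ %-cong-+ˡ a (sym (n∣m⇒m%n≡0 _ i i∣offset)) ⟩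
      (a + offset M a b) % i ≡⟨ offset-spec-∣ i∣M b a≤M ⟩
      b % i                  ∎
      where open ≡-Reasoning

  offset-unit : ∀ {a b} → 1 < M → a ≤ M → Coprime ∣ a - b ∣ M → IsUnit M (offset M a b)
  offset-unit {a} {b} 1<M a≤M cop =
    coprime⇒>0 1<M (offset-coprime a≤M cop) , offset-< a b , offset-coprime a≤M cop

suc-coprime? : ∀ n → Decidable (λ j → gcd (suc j) n ≡ 1)
suc-coprime? n j = gcd (suc j) n ≟ 1

unitsUpTo : ℕ → ℕ → ℕ
unitsUpTo n i = length (filter (suc-coprime? n) (upTo i))

module _ {n : ℕ} where

  unitsUpTo-suc : ∀ i → unitsUpTo n (suc i) ≡ unitsUpTo n i + length (filter (suc-coprime? n) [ i ])
  unitsUpTo-suc i = begin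
    length (filter P? (upTo (suc i)))              ≡⟨ cong (length ∘ filter P?) (upTo-∷ʳ i) ⟨
    length (filter P? (upTo i ++ [ i ]))           ≡⟨ cong length (filter-++ P? (upTo i) [ i ]) ⟩
    length (filter P? (upTo i) ++ filter P? [ i ]) ≡⟨ length-++ (filter P? (upTo i)) ⟩
    unitsUpTo n i + length (filter P? [ i ])       ∎
    where
    open ≡-Reasoning
    P? : Decidable (λ j → gcd (suc j) n ≡ 1)
    P? = suc-coprime? n

  unitsUpTo-≤-suc : ∀ i → unitsUpTo n i ≤ unitsUpTo n (suc i)
  unitsUpTo-≤-suc i rewrite unitsUpTo-suc i = m≤m+n _ _

  unitsUpTo-<-suc : ∀ i → Coprime (suc i) n → unitsUpTo n i < unitsUpTo n (suc i)
  unitsUpTo-<-suc i cop rewrite unitsUpTo-suc i | filter-accept (suc-coprime? n) {xs = []} (coprime⇒gcd≡1 cop) =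
    m<m+n _ (s≤s z≤n)

  unitsUpTo-mono : ∀ {i j} → i ≤ j → unitsUpTo n i ≤ unitsUpTo n j
  unitsUpTo-mono {j = zero}  z≤n = ≤-refl
  unitsUpTo-mono {i} {suc j} i≤1+j with m≤n⇒m<n∨m≡n i≤1+j
  ... | inj₁ i<1+j = ≤-trans (unitsUpTo-mono (s≤s⁻¹ i<1+j)) (unitsUpTo-≤-suc j)
  ... | inj₂ refl  = ≤-refl

  -- The units 1 ≤ u < n are numbered 0, 1, …, φ n - 1 in increasing order; nothing gets φ n.
  colourIndex : Maybe ℕ → ℕ
  colourIndex nothing  = φ n
  colourIndex (just u) = unitsUpTo n (pred u)

  colourIndex-<-unit : ∀ {u v} → IsUnit n u → u < v → colourIndex (just u) < colourIndex (just v)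
  colourIndex-<-unit {suc i} {suc j} (_ , _ , cop) (s≤s i<j) =
    <-≤-trans (unitsUpTo-<-suc i cop) (unitsUpTo-mono i<j)

  colourIndex-unit-< : ∀ {u} → IsUnit n u → colourIndex (just u) < φ n
  colourIndex-unit-< {suc i} (_ , u<n , cop) = <-≤-trans (unitsUpTo-<-suc i cop) (unitsUpTo-mono (<⇒≤ u<n))

  colourIndex-< : ∀ {c} → All (IsUnit n) c → colourIndex c < suc (φ n)
  colourIndex-< nothing       = ≤-refl
  colourIndex-< (just unit-u) = m<n⇒m<1+n (colourIndex-unit-< unit-u)

  colourIndex-injective : ∀ {c c′} → All (IsUnit n) c → All (IsUnit n) c′ →
                          colourIndex c ≡ colourIndex c′ → c ≡ c′
  colourIndex-injective nothing  nothing   _  = refl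
  colourIndex-injective nothing (just unit-v) eq = contradiction (sym eq) (<⇒≢ (colourIndex-unit-< unit-v))
  colourIndex-injective (just unit-u) nothing eq = contradiction eq (<⇒≢ (colourIndex-unit-< unit-u))
  colourIndex-injective {just u} {just v} (just unit-u) (just unit-v) eq with <-cmp u v
  ... | tri< u<v _ _  = contradiction eq (<⇒≢ (colourIndex-<-unit unit-u u<v))
  ... | tri≈ _ refl _ = refl
  ... | tri> _ _ v<u  = contradiction (sym eq) (<⇒≢ (colourIndex-<-unit unit-v v<u))

UAdj-sym : ∀ {n} {x y : Fin n} → UAdj n x y → UAdj n y x
UAdj-sym {n} {x} {y} (x≢y , cop) =
  (λ y≡x → x≢y (sym y≡x)) , subst (λ t → gcd t n ≡ 1) (∣-∣-comm (toℕ x) (toℕ y)) cop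

UAdj⇒%≢ : ∀ {n d} .{{_ : NonZero d}} {x y : Fin n} → UAdj n x y → d ∣ n → d ≢ 1 → toℕ x % d ≢ toℕ y % d
UAdj⇒%≢ (_ , cop) d∣n d≢1 eq = d≢1 (gcd≡1⇒coprime cop (%≡%⇒∣∣-∣ eq , d∣n))

ClosedNbr : (n : ℕ) → Fin n → Fin n → Set
ClosedNbr n x y = y ≡ x ⊎ UAdj n x y

record DiagonalColouring (n : ℕ) : Set where
  field
    colour           : Fin n → Fin n → Maybe ℕ
    colour-unit      : ∀ {x y} → ClosedNbr n x y → All (IsUnit n) (colour x y)
    colour-sym       : ∀ {x y} → UAdj n x y → colour x y ≡ colour y x
    colour-injective : ∀ {x y z} → ClosedNbr n x y → ClosedNbr n x z → colour x y ≡ colour x z → y ≡ z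
    diagonal-proper  : ∀ {x y} → UAdj n x y → colour x x ≢ colour y y

toTotalColoring : ∀ {n} → DiagonalColouring n → TotalColoring n (suc (φ n))
toTotalColoring {n} C = record
  { vcol             = λ x → index (vertex-unit x)
  ; ecol             = λ x y xy → index (edge-unit xy)
  ; ecol-sym         = λ x y xy yx → fromℕ<-cong _ _ (cong colourIndex (colour-sym xy)) _ _
  -- fromℕ< ignores its irrelevant bound argument
  ; ecol-irr         = λ x y xy xy′ → refl
  ; vertex-proper    = λ x y xy eq → diagonal-proper xy (same-colour (vertex-unit x) (vertex-unit y) eq)
  ; edge-proper      = λ x y z xy xz y≢z eq →
      y≢z (colour-injective (inj₂ xy) (inj₂ xz) (same-colour (edge-unit xy) (edge-unit xz) eq))
  ; incidence-proper = λ x y xy →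
      (λ eq → proj₁ xy (sym (colour-injective (inj₂ xy) (inj₁ refl)
                               (same-colour (edge-unit xy) (vertex-unit x) eq)))) ,
      (λ eq → proj₁ xy (colour-injective (inj₂ (UAdj-sym xy)) (inj₁ refl)
                          (trans (sym (colour-sym xy)) (same-colour (edge-unit xy) (vertex-unit y) eq))))
  }
  where
  open DiagonalColouring C

  vertex-unit : ∀ x → All (IsUnit n) (colour x x)
  vertex-unit x = colour-unit (inj₁ refl)

  edge-unit : ∀ {x y} → UAdj n x y → All (IsUnit n) (colour x y)
  edge-unit xy = colour-unit (inj₂ xy)

  index : ∀ {x y} → All (IsUnit n) (colour x y) → Fin (suc (φ n))
  index unit = fromℕ< (colourIndex-< unit)

  same-colour : ∀ {x y x′ y′} (u : All (IsUnit n) (colour x y)) (u′ : All (IsUnit n) (colour x′ y′)) →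
                index u ≡ index u′ → colour x y ≡ colour x′ y′
  same-colour u u′ eq = colourIndex-injective u u′ (fromℕ<-injective _ _ _ _ eq)

leastDivisor : ∀ m → 1 < m → ∃[ q ] (1 < q × q ∣ m × q Rough m)
leastDivisor m 1<m = search (m ∸ 2) 2 (s≤s (s≤s z≤n)) (m∸n+n≡m 1<m) 2-rough
  where
  search : ∀ k d → 1 < d → k + d ≡ m → d Rough m → ∃[ q ] (1 < q × q ∣ m × q Rough m)
  search k d 1<d eq rough with d ∣? m
  ... | yes d∣m = d , 1<d , d∣m , rough
  search zero    d 1<d eq rough | no d∤m = contradiction (subst (d ∣_) eq ∣-refl) d∤m
  search (suc k) d 1<d eq rough | no d∤m =
    search k (suc d) (m<n⇒m<1+n 1<d) (trans (+-suc k d) eq) (∤⇒rough-suc d∤m rough)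

rough⇒coprime : ∀ {q m c} → q Rough m → 0 < c → c < q → Coprime c m
rough⇒coprime rough 0<c c<q {zero} (0∣c , _) = contradiction (0∣⇒≡0 0∣c) (>⇒≢ 0<c)
rough⇒coprime rough 0<c c<q {1} _ = refl
rough⇒coprime rough 0<c c<q {suc (suc i)} (i∣c , i∣m) =
  contradiction (hasNonTrivialDivisor (≤-<-trans (∣⇒≤ {{>-nonZero 0<c}} i∣c) c<q) i∣m) rough

-- A colour is a pair (J, l) with J < p and l < p^k, encoded as the unit J + l p when
-- J ≠ 0 and as nothing when J = 0.
module OddPrimePower (p k : ℕ) (p-prime : Prime p) (p-odd : ¬ 2 ∣ p) where

  instance
    p≢0 : NonZero p
    p≢0 = prime⇒nonZero p-prime

  N : ℕ
  N = p ^ k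

  n : ℕ
  n = p * N

  instance
    N≢0 : NonZero N
    N≢0 = m^n≢0 p k

  res lay : Fin n → ℕ
  res x = toℕ x % p
  lay x = toℕ x / p

  res< : ∀ x → res x < p
  res< x = m%n<n (toℕ x) p

  lay< : ∀ x → lay x < N
  lay< x = m<n*o⇒m/o<n (subst (toℕ x <_) (*-comm p N) (toℕ<n x))

  res-lay-injective : ∀ {y z} → res y ≡ res z → lay y ≡ lay z → y ≡ z
  res-lay-injective {y} {z} r s = toℕ-injective (begin
    toℕ y                     ≡⟨ m≡m%n+[m/n]*n (toℕ y) p ⟩
    res y + lay y * p         ≡⟨ cong₂ (λ a b → a + b * p) r s ⟩
    res z + lay z * p         ≡⟨ sym (m≡m%n+[m/n]*n (toℕ z) p) ⟩
    toℕ z                     ∎)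
    where open ≡-Reasoning

  UAdj⇒res≢ : ∀ {x y} → UAdj n x y → res x ≢ res y
  UAdj⇒res≢ xy = UAdj⇒%≢ xy (m∣m*n N) (nonTrivial⇒≢1 {{prime⇒nonTrivial p-prime}})

  tag : ℕ → ℕ → Maybe ℕ
  tag zero    l = nothing
  tag J@(suc _) l = just (J + l * p)

  tag-value-% : ∀ {J} l → J < p → (J + l * p) % p ≡ J
  tag-value-% {J} l J<p = trans ([m+kn]%n≡m%n J l p) (m<n⇒m%n≡m J<p)

  tag-unit : ∀ {J l} → J < p → l < N → All (IsUnit n) (tag J l)
  tag-unit {zero}      J<p l<N = nothing
  tag-unit {J@(suc _)} {l} J<p l<N =
    just (s≤s z≤n , J+lp<n , coprime-^ʳ (prime∤⇒coprime p-prime p∤J+lp) (suc k))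
    where
    J+lp<n : J + l * p < n
    J+lp<n = begin-strict
      J + l * p <⟨ +-monoˡ-< (l * p) J<p ⟩
      suc l * p ≤⟨ *-monoˡ-≤ p l<N ⟩
      N * p     ≡⟨ *-comm N p ⟩
      n         ∎
      where open ≤-Reasoning
    p∤J+lp : ¬ p ∣ J + l * p
    p∤J+lp p∣ = contradiction (trans (sym (tag-value-% l J<p)) (n∣m⇒m%n≡0 _ p p∣)) (λ ())

  tag-injective : ∀ {J J′ l l′} → J < p → J′ < p → tag J l ≡ tag J′ l′ → J ≡ J′ × (J ≢ 0 → l ≡ l′)
  tag-injective {zero} {zero} _ _ _ = refl , λ 0≢0 → contradiction refl 0≢0
  tag-injective {J@(suc _)} {J′@(suc _)} {l} {l′} J<p J′<p eq = J≡J′ , λ _ → l≡l′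
    where
    eq′ : J + l * p ≡ J′ + l′ * p
    eq′ = just-injective eq
    J≡J′ : J ≡ J′
    J≡J′ = trans (sym (tag-value-% l J<p)) (trans (cong (_% p) eq′) (tag-value-% l′ J′<p))
    l≡l′ : l ≡ l′
    l≡l′ = *-cancelʳ-≡ l l′ p (+-cancelˡ-≡ J _ _ (trans eq′ (cong (_+ l′ * p) (sym J≡J′))))

  residueColour : ℕ → ℕ → ℕ → ℕ → ℕ
  residueColour a s b t with <-cmp s t
  ... | tri< _ _ _ = offset p a b
  ... | tri≈ _ _ _ = (a + b) % p
  ... | tri> _ _ _ = offset p b a

  residueColour-< : ∀ a s b t → residueColour a s b t < p
  residueColour-< a s b t with <-cmp s t
  ... | tri< _ _ _ = offset-< a b
  ... | tri≈ _ _ _ = m%n<n (a + b) p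
  ... | tri> _ _ _ = offset-< b a

  residueColour-sym : ∀ a s b t → residueColour a s b t ≡ residueColour b t a s
  residueColour-sym a s b t with <-cmp s t | <-cmp t s
  ... | tri< _ _ _    | tri> _ _ _    = refl
  ... | tri≈ _ _ _    | tri≈ _ _ _    = cong (_% p) (+-comm a b)
  ... | tri> _ _ _    | tri< _ _ _    = refl
  ... | tri< _ _ s≯t  | tri< t<s _ _  = contradiction t<s s≯t
  ... | tri< _ s≢t _  | tri≈ _ t≡s _  = contradiction (sym t≡s) s≢t
  ... | tri≈ s≮t _ _  | tri> _ _ s<t  = contradiction s<t s≮t
  ... | tri≈ _ _ s≯t  | tri< t<s _ _  = contradiction t<s s≯t
  ... | tri> _ s≢t _  | tri≈ _ t≡s _  = contradiction (sym t≡s) s≢t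
  ... | tri> s≮t _ _  | tri> _ _ s<t  = contradiction s<t s≮t

  residueColour-diagonal : ∀ a s → residueColour a s a s ≡ (a + a) % p
  residueColour-diagonal a s with <-cmp s s
  ... | tri< _ s≢s _ = contradiction refl s≢s
  ... | tri≈ _ _ _   = refl
  ... | tri> _ s≢s _ = contradiction refl s≢s

  residueColour-injective : ∀ {a s b c t} → a < p → b < p → c < p →
                            residueColour a s b t ≡ residueColour a s c t → b ≡ c
  residueColour-injective {a} {s} {b} {c} {t} a<p b<p c<p eq with <-cmp s t
  ... | tri< _ _ _ = %≡%⇒≡ b<p c<p (to (offset-%-congʳ {p} ∣-refl (<⇒≤ a<p)) (cong (_% p) eq))
  ... | tri≈ _ _ _ = %≡%⇒≡ b<p c<p (+-cancelˡ-% a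
                       (trans (sym (m%n%n≡m%n (a + b) p)) (trans (cong (_% p) eq) (m%n%n≡m%n (a + c) p))))
  ... | tri> _ _ _ = %≡%⇒≡ b<p c<p (to (offset-%-congˡ {p} ∣-refl (<⇒≤ b<p) (<⇒≤ c<p)) (cong (_% p) eq))

  residueColour≡0⇒≡ : ∀ {a s b t} → a < p → b < p → a ≢ b → residueColour a s b t ≡ 0 → s ≡ t
  residueColour≡0⇒≡ {a} {s} {b} {t} a<p b<p a≢b eq with <-cmp s t
  ... | tri< _ _ _   = contradiction (%≡%⇒≡ a<p b<p (offset≡0⇒%≡% (<⇒≤ a<p) eq)) a≢b
  ... | tri≈ _ s≡t _ = s≡t
  ... | tri> _ _ _   = contradiction (sym (%≡%⇒≡ b<p a<p (offset≡0⇒%≡% (<⇒≤ b<p) eq))) a≢b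

  colourRes colourLay : Fin n → Fin n → ℕ
  colourRes x y = residueColour (res x) (lay x) (res y) (lay y)
  colourLay x y = (lay x + lay y) % N

  colour : Fin n → Fin n → Maybe ℕ
  colour x y = tag (colourRes x y) (colourLay x y)

  colourRes-< : ∀ x y → colourRes x y < p
  colourRes-< x y = residueColour-< (res x) (lay x) (res y) (lay y)

  colour-≡ : ∀ {x y x′ y′} → colour x y ≡ colour x′ y′ →
             colourRes x y ≡ colourRes x′ y′ × (colourRes x y ≢ 0 → colourLay x y ≡ colourLay x′ y′)
  colour-≡ {x} {y} {x′} {y′} = tag-injective (colourRes-< x y) (colourRes-< x′ y′)

  ClosedNbr⇒sameLayer : ∀ {x y} → ClosedNbr n x y → colourRes x y ≡ 0 → lay x ≡ lay y
  ClosedNbr⇒sameLayer (inj₁ refl) _  = refl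
  ClosedNbr⇒sameLayer {x} {y} (inj₂ xy) eq = residueColour≡0⇒≡ (res< x) (res< y) (UAdj⇒res≢ xy) eq

  colour-injective : ∀ {x y z} → ClosedNbr n x y → ClosedNbr n x z → colour x y ≡ colour x z → y ≡ z
  colour-injective {x} {y} {z} xy xz eq = res-lay-injective res≡ lay≡
    where
    lay≡ : lay y ≡ lay z
    lay≡ with colourRes x y ≟ 0
    ... | yes J≡0 = trans (sym (ClosedNbr⇒sameLayer xy J≡0))
                          (ClosedNbr⇒sameLayer xz (trans (sym (proj₁ (colour-≡ eq))) J≡0))
    ... | no J≢0  = %≡%⇒≡ (lay< y) (lay< z) (+-cancelˡ-% (lay x) (proj₂ (colour-≡ eq) J≢0))

    res≡ : res y ≡ res z
    res≡ = residueColour-injective {res x} {lay x} {t = lay y} (res< x) (res< y) (res< z)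
             (subst (λ t → colourRes x y ≡ residueColour (res x) (lay x) (res z) t) (sym lay≡)
                    (proj₁ (colour-≡ eq)))

  diagonal-proper : ∀ {x y} → UAdj n x y → colour x x ≢ colour y y
  diagonal-proper {x} {y} xy eq = UAdj⇒res≢ xy (%≡%⇒≡ (res< x) (res< y) (double-cancel-% p-odd doubles))
    where
    doubles : (res x + res x) % p ≡ (res y + res y) % p
    doubles = trans (sym (residueColour-diagonal (res x) (lay x)))
                    (trans (proj₁ (colour-≡ eq)) (residueColour-diagonal (res y) (lay y)))

  diagonalColouring : DiagonalColouring n
  diagonalColouring = record
    { colour           = colour
    ; colour-unit      = λ {x} {y} _ → tag-unit (colourRes-< x y) (m%n<n (lay x + lay y) N)
    ; colour-sym       = λ {x} {y} _ →
        cong₂ tag (residueColour-sym (res x) (lay x) (res y) (lay y)) (cong (_% N) (+-comm (lay x) (lay y)))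
    ; colour-injective = colour-injective
    ; diagonal-proper  = diagonal-proper
    }

%2≢0⇒%2≡1 : ∀ a → a % 2 ≢ 0 → a % 2 ≡ 1
%2≢0⇒%2≡1 a a%2≢0 with a % 2 | m%n<n a 2
... | zero        | _               = contradiction refl a%2≢0
... | suc zero    | _               = refl
... | suc (suc _) | s≤s (s≤s ())

-- difference x y is the odd end minus the even end of the pair, mod n.  A difference is
-- Special when it is the chosen representative of its class mod q (0 for the class 0, an
-- odd unit otherwise); such pairs are coloured by the class of x + y mod q instead.
module OddMultipleOfPowerOfTwo (k m : ℕ) (1<m : 1 < m) (m-odd : ¬ 2 ∣ m) where

  n : ℕ
  n = 2 ^ suc k * m

  q : ℕ
  q = proj₁ (leastDivisor m 1<m)

  1<q : 1 < q
  1<q = proj₁ (proj₂ (leastDivisor m 1<m))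

  q∣m : q ∣ m
  q∣m = proj₁ (proj₂ (proj₂ (leastDivisor m 1<m)))

  q-rough : q Rough m
  q-rough = proj₂ (proj₂ (proj₂ (leastDivisor m 1<m)))

  instance
    m≢0 : NonZero m
    m≢0 = >-nonZero (<⇒≤ 1<m)
    q≢0 : NonZero q
    q≢0 = >-nonZero (<⇒≤ 1<q)
    n≢0 : NonZero n
    n≢0 = m*n≢0 (2 ^ suc k) m {{m^n≢0 2 (suc k)}}

  q∣n : q ∣ n
  q∣n = ∣n⇒∣m*n (2 ^ suc k) q∣m

  2∣n : 2 ∣ n
  2∣n = ∣m⇒∣m*n m (m∣m*n (2 ^ k))

  q-odd : ¬ 2 ∣ q
  q-odd 2∣q = m-odd (∣-trans 2∣q q∣m)

  2m≤n : m + m ≤ n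
  2m≤n = subst (_≤ n) (cong (m +_) (+-identityʳ m)) (*-monoˡ-≤ m (*-monoʳ-≤ 2 (m^n>0 2 k)))

  1<n : 1 < n
  1<n = <-≤-trans 1<m (≤-trans (m≤m+n m m) 2m≤n)

  oddLift : ℕ → ℕ
  oddLift c with 2 ∣? c
  ... | yes _ = c + m
  ... | no _  = c

  oddLift-% : ∀ c → oddLift c % q ≡ c % q
  oddLift-% c with 2 ∣? c
  ... | yes _ = %-remove-+ʳ c q∣m
  ... | no _  = refl

  oddLift-unit : ∀ {c} → 0 < c → c < q → IsUnit n (oddLift c)
  oddLift-unit {c} 0<c c<q = <-≤-trans 0<c (c≤lift c) , ≤-<-trans (lift≤c+m c) lift<n , coprime-*ʳ
    (coprime-^ʳ (prime∤⇒coprime prime[2] (odd c)) (suc k))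
    (coprime-m (rough⇒coprime q-rough 0<c c<q))
    where
    c≤lift : ∀ c → c ≤ oddLift c
    c≤lift c with 2 ∣? c
    ... | yes _ = m≤m+n c m
    ... | no _  = ≤-refl
    lift≤c+m : ∀ c → oddLift c ≤ c + m
    lift≤c+m c with 2 ∣? c
    ... | yes _ = ≤-refl
    ... | no _  = m≤m+n c m
    lift<n : c + m < n
    lift<n = <-≤-trans (+-monoˡ-< m (<-≤-trans c<q (∣⇒≤ q∣m))) 2m≤n
    odd : ∀ c → ¬ 2 ∣ oddLift c
    odd c with 2 ∣? c
    ... | yes 2∣c = λ 2∣c+m → m-odd (∣m+n∣m⇒∣n 2∣c+m 2∣c)
    ... | no 2∤c  = 2∤c
    coprime-m : Coprime c m → Coprime (oddLift c) m
    coprime-m cop with 2 ∣? c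
    ... | yes _ = subst (λ t → Coprime t m) (+-comm m c) (coprime-+ cop)
    ... | no _  = cop

  representative : ℕ → ℕ
  representative zero        = zero
  representative c@(suc _) = oddLift c

  representative-% : ∀ {c} → c < q → representative c % q ≡ c
  representative-% {zero}      c<q = m<n⇒m%n≡m c<q
  representative-% {c@(suc _)} c<q = trans (oddLift-% c) (m<n⇒m%n≡m c<q)

  Special : ℕ → Set
  Special d = representative (d % q) ≡ d

  Special? : ∀ d → Dec (Special d)
  Special? d = representative (d % q) ≟ d

  Special-injective : ∀ {d d′} → Special d → Special d′ → d % q ≡ d′ % q → d ≡ d′
  Special-injective sd sd′ eq = trans (sym sd) (trans (cong representative eq) sd′)

  classColour : ℕ → Maybe ℕ
  classColour zero        = nothing
  classColour c@(suc _) = just (oddLift c)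

  classColour-unit : ∀ {c} → c < q → All (IsUnit n) (classColour c)
  classColour-unit {zero}  _   = nothing
  classColour-unit {suc c} c<q = just (oddLift-unit (s≤s z≤n) c<q)

  classColour-injective : ∀ {c c′} → c < q → c′ < q → classColour c ≡ classColour c′ → c ≡ c′
  classColour-injective {zero}  {zero}   _   _    _  = refl
  classColour-injective {suc c} {suc c′} c<q c′<q eq =
    trans (sym (representative-% c<q)) (trans (cong (_% q) (just-injective eq)) (representative-% c′<q))

  classColour-%-injective : ∀ a b → classColour (a % q) ≡ classColour (b % q) → a % q ≡ b % q
  classColour-%-injective a b = classColour-injective (m%n<n a q) (m%n<n b q)

  classColour-Special : ∀ {c d} → c < q → classColour c ≡ just d → Special d
  classColour-Special {suc c} c<q refl = cong representative (representative-% c<q)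

  paint : ℕ → ℕ → Maybe ℕ
  paint d c with Special? d
  ... | yes _ = classColour c
  ... | no _  = just d

  paint-Special : ∀ {d c} → Special d → paint d c ≡ classColour c
  paint-Special {d} sd with Special? d
  ... | yes _  = refl
  ... | no ¬sd = contradiction sd ¬sd

  paint-unit : ∀ {d c} → IsUnit n d → c < q → All (IsUnit n) (paint d c)
  paint-unit {d} unit-d c<q with Special? d
  ... | yes _ = classColour-unit c<q
  ... | no _  = just unit-d

  difference : Fin n → Fin n → ℕ
  difference x y with toℕ x % 2 ≟ 0
  ... | yes _ = offset n (toℕ x) (toℕ y)
  ... | no _  = offset n (toℕ y) (toℕ x)

  toℕ≤n : ∀ (x : Fin n) → toℕ x ≤ n
  toℕ≤n x = <⇒≤ (toℕ<n x)

  difference-self : ∀ x → difference x x ≡ 0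
  difference-self x with toℕ x % 2 ≟ 0
  ... | yes _ = offset-self (toℕ≤n x)
  ... | no _  = offset-self (toℕ≤n x)

  difference-sym : ∀ {x y} → UAdj n x y → difference x y ≡ difference y x
  difference-sym {x} {y} xy with toℕ x % 2 ≟ 0 | toℕ y % 2 ≟ 0
  ... | yes x-even | yes y-even = contradiction (trans x-even (sym y-even)) (UAdj⇒%≢ xy 2∣n (λ ()))
  ... | yes _      | no _       = refl
  ... | no _       | yes _      = refl
  ... | no x-odd   | no y-odd   =
    contradiction (trans (%2≢0⇒%2≡1 (toℕ x) x-odd) (sym (%2≢0⇒%2≡1 (toℕ y) y-odd))) (UAdj⇒%≢ xy 2∣n (λ ()))

  difference-injective : ∀ {x y z} → difference x y ≡ difference x z → y ≡ z
  difference-injective {x} {y} {z} eq = toℕ-injective (%≡%⇒≡ (toℕ<n y) (toℕ<n z) (lemma eq))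
    where
    lemma : difference x y ≡ difference x z → toℕ y % n ≡ toℕ z % n
    lemma eq with toℕ x % 2 ≟ 0
    ... | yes _ = to (offset-%-congʳ {n} ∣-refl (toℕ≤n x)) (cong (_% n) eq)
    ... | no _  = to (offset-%-congˡ {n} ∣-refl (toℕ≤n y) (toℕ≤n z)) (cong (_% n) eq)

  difference-% : ∀ {x y z} → toℕ y % q ≡ toℕ z % q → difference x y % q ≡ difference x z % q
  difference-% {x} {y} {z} eq with toℕ x % 2 ≟ 0
  ... | yes _ = from (offset-%-congʳ {n} q∣n (toℕ≤n x)) eq
  ... | no _  = from (offset-%-congˡ {n} q∣n (toℕ≤n y) (toℕ≤n z)) eq

  difference-unit : ∀ {x y} → UAdj n x y → IsUnit n (difference x y)
  difference-unit {x} {y} xy with toℕ x % 2 ≟ 0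
  ... | yes _ = offset-unit 1<n (toℕ≤n x) (gcd≡1⇒coprime (proj₂ xy))
  ... | no _  = offset-unit 1<n (toℕ≤n y) (gcd≡1⇒coprime (proj₂ (UAdj-sym xy)))

  colour : Fin n → Fin n → Maybe ℕ
  colour x y = paint (difference x y) ((toℕ x + toℕ y) % q)

  colour-diagonal : ∀ x → colour x x ≡ classColour ((toℕ x + toℕ x) % q)
  colour-diagonal x =
    trans (cong (λ d → paint d ((toℕ x + toℕ x) % q)) (difference-self x)) (paint-Special {0} Special-0)
    where
    Special-0 : Special 0
    Special-0 = cong representative (m<n⇒m%n≡m (<⇒≤ 1<q))

  colour-injective : ∀ {x y z} → colour x y ≡ colour x z → y ≡ z
  colour-injective {x} {y} {z} eq with Special? (difference x y) | Special? (difference x z)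
  ... | yes sy | yes sz = difference-injective {x} (Special-injective sy sz (difference-% {x} y≡z))
    where
    y≡z : toℕ y % q ≡ toℕ z % q
    y≡z = +-cancelˡ-% (toℕ x) (classColour-%-injective (toℕ x + toℕ y) (toℕ x + toℕ z) eq)
  ... | yes _  | no ¬sz = contradiction (classColour-Special (m%n<n (toℕ x + toℕ y) q) eq) ¬sz
  ... | no ¬sy | yes _  = contradiction (classColour-Special (m%n<n (toℕ x + toℕ z) q) (sym eq)) ¬sy
  ... | no _   | no _   = difference-injective {x} (just-injective eq)

  colour-unit : ∀ {x y} → ClosedNbr n x y → All (IsUnit n) (colour x y)
  colour-unit {x} (inj₁ refl) = subst (All (IsUnit n)) (sym (colour-diagonal x)) (classColour-unit (m%n<n _ q))
  colour-unit     (inj₂ xy)   = paint-unit (difference-unit xy) (m%n<n _ q)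

  diagonal-proper : ∀ {x y} → UAdj n x y → colour x x ≢ colour y y
  diagonal-proper {x} {y} xy eq = UAdj⇒%≢ xy q∣n (>⇒≢ 1<q) (double-cancel-% q-odd doubles)
    where
    doubles : (toℕ x + toℕ x) % q ≡ (toℕ y + toℕ y) % q
    doubles = classColour-%-injective (toℕ x + toℕ x) (toℕ y + toℕ y)
                (trans (sym (colour-diagonal x)) (trans eq (colour-diagonal y)))

  diagonalColouring : DiagonalColouring n
  diagonalColouring = record
    { colour           = colour
    ; colour-unit      = colour-unit
    ; colour-sym       = λ {x} {y} xy → cong₂ paint (difference-sym xy) (cong (_% q) (+-comm (toℕ x) (toℕ y)))
    ; colour-injective = λ _ _ → colour-injective
    ; diagonal-proper  = diagonal-proper
    }

theorem2p2 : ∀ (n : ℕ) →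
    ((∃[ k ] ∃[ m ] (0 < k × 1 < m × ¬ (2 ∣ m) × n ≡ 2 ^ k * m))
     ⊎ (∃[ p ] ∃[ k ] (Prime p × ¬ (2 ∣ p) × 0 < k × n ≡ p ^ k))) →
    TotalColoring n (suc (φ n))
theorem2p2 n (inj₁ (suc k , m , _ , 1<m , m-odd , refl)) =
  toTotalColoring (OddMultipleOfPowerOfTwo.diagonalColouring k m 1<m m-odd)
theorem2p2 n (inj₂ (p , suc k , p-prime , p-odd , _ , refl)) =
  toTotalColoring (OddPrimePower.diagonalColouring p k p-prime p-odd)
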